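{- For all positive integers $n,m$, the third distance ideal $I_3^{\mathbb Q}(K_{n,m})$ of the complete bipartite graph $K_{n,m}$ over $\mathbb Q[X]$ is not trivial.
   Context: For a connected graph $G$ with vertex set $V$, let $X=\{x_u:u\in V\}$ be indeterminates, $D(G)$ the distance matrix (entries $d_G(u,v)$), and $D_X(G)=\operatorname{diag}(X)+D(G)$. The $i$-th distance ideal $I_i^{\mathbb Q}(G)$ is the ideal of $\mathbb Q[X]$ generated by all $i\times i$ minors of $D_X(G)$; an ideal is trivial if it equals $\mathbb Q[X]$. -}

module Defs where

open import Data.Nat using (ℕ; zero; suc; _+_; _<?_)
open import Data.Fin using (Fin; zero; suc; toℕ; punchIn; _≟_)
import Data.Fin as F
open import Data.Rational using (ℚ; 0ℚ; 1ℚ) renaming (_+_ to _+ℚ_; _*_ to _*ℚ_; -_ to -ℚ_)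
open import Data.Product using (Σ; _×_; ∃)
open import Relation.Binary.PropositionalEquality using (_≡_)
open import Relation.Nullary using (¬_; yes; no)

-- The polynomial ring ℚ[X], X = {x_u : u ∈ Fin N}, presented as the free
-- commutative ℚ-algebra on the variables: syntax modulo the congruence
-- generated by the commutative-ring axioms and the requirement that the
-- embedding of constants is a ring homomorphism.

infixl 6 _⊕_
infixl 7 _⊗_

data Poly (N : ℕ) : Set where
  con : ℚ → Poly N
  var : Fin N → Poly N
  _⊕_ : Poly N → Poly N → Poly N
  _⊗_ : Poly N → Poly N → Poly N
  ⊝_  : Poly N → Poly N

infix 4 _≈_

data _≈_ {N : ℕ} : Poly N → Poly N → Set where
  ≈-refl  : ∀ {p} → p ≈ p
  ≈-sym   : ∀ {p q} → p ≈ q → q ≈ p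
  ≈-trans : ∀ {p q r} → p ≈ q → q ≈ r → p ≈ r
  ⊕-cong  : ∀ {p p' q q'} → p ≈ p' → q ≈ q' → p ⊕ q ≈ p' ⊕ q'
  ⊗-cong  : ∀ {p p' q q'} → p ≈ p' → q ≈ q' → p ⊗ q ≈ p' ⊗ q'
  ⊝-cong  : ∀ {p q} → p ≈ q → ⊝ p ≈ ⊝ q
  ⊕-assoc : ∀ p q r → (p ⊕ q) ⊕ r ≈ p ⊕ (q ⊕ r)
  ⊕-comm  : ∀ p q → p ⊕ q ≈ q ⊕ p
  ⊕-idˡ   : ∀ p → con 0ℚ ⊕ p ≈ p
  ⊝-invˡ  : ∀ p → (⊝ p) ⊕ p ≈ con 0ℚ
  ⊗-assoc : ∀ p q r → (p ⊗ q) ⊗ r ≈ p ⊗ (q ⊗ r)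
  ⊗-comm  : ∀ p q → p ⊗ q ≈ q ⊗ p
  ⊗-idˡ   : ∀ p → con 1ℚ ⊗ p ≈ p
  distribˡ : ∀ p q r → p ⊗ (q ⊕ r) ≈ (p ⊗ q) ⊕ (p ⊗ r)
  con-+   : ∀ a b → con (a +ℚ b) ≈ con a ⊕ con b
  con-*   : ∀ a b → con (a *ℚ b) ≈ con a ⊗ con b
  con--   : ∀ a → con (-ℚ a) ≈ ⊝ con a

data InIdeal {N : ℕ} (S : Poly N → Set) : Poly N → Set where
  gen  : ∀ {p} → S p → InIdeal S p
  zero : InIdeal S (con 0ℚ)
  add  : ∀ {p q} → InIdeal S p → InIdeal S q → InIdeal S (p ⊕ q)
  mul  : ∀ r {p} → InIdeal S p → InIdeal S (r ⊗ p)
  resp : ∀ {p q} → p ≈ q → InIdeal S p → InIdeal S q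

Trivial : {N : ℕ} → (Poly N → Set) → Set
Trivial {N} I = (p : Poly N) → I p

sumF : ∀ {N} k → (Fin k → Poly N) → Poly N
sumF zero    f = con 0ℚ
sumF (suc k) f = f zero ⊕ sumF k (λ j → f (suc j))

signQ : ℕ → ℚ
signQ zero    = 1ℚ
signQ (suc n) = -ℚ (signQ n)

det : ∀ {N} k → (Fin k → Fin k → Poly N) → Poly N
det zero    M = con 1ℚ
det (suc k) M =
  sumF (suc k) (λ j → con (signQ (toℕ j)) ⊗
    (M zero j ⊗ det k (λ a b → M (suc a) (punchIn j b))))

StrictlyIncreasing : ∀ {i N} → (Fin i → Fin N) → Set
StrictlyIncreasing r = ∀ a b → a F.< b → r a F.< r b

IsMinor : ∀ {N} (i : ℕ) → (Fin N → Fin N → Poly N) → Poly N → Set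
IsMinor {N} i M p =
  Σ (Fin i → Fin N) λ r → Σ (Fin i → Fin N) λ c →
    StrictlyIncreasing r × StrictlyIncreasing c ×
    (p ≡ det i (λ a b → M (r a) (c b)))

-- Complete bipartite graph K_{n,m}: vertex set Fin (n + m), the first n
-- vertices form one part, the remaining m the other.

2ℚ : ℚ
2ℚ = 1ℚ +ℚ 1ℚ

distK : (n m : ℕ) → Fin (n + m) → Fin (n + m) → ℚ
distK n m u v with u ≟ v
... | yes _ = 0ℚ
... | no _ with toℕ u <? n | toℕ v <? n
...   | yes _ | yes _ = 2ℚ
...   | no _  | no _  = 2ℚ
...   | yes _ | no _  = 1ℚ
...   | no _  | yes _ = 1ℚ

DX-K : (n m : ℕ) → Fin (n + m) → Fin (n + m) → Poly (n + m)
DX-K n m u v with u ≟ v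
... | yes _ = var u ⊕ con (distK n m u v)
... | no _  = con 0ℚ ⊕ con (distK n m u v)

DistanceIdealK : (i n m : ℕ) → Poly (n + m) → Set
DistanceIdealK i n m = InIdeal (IsMinor i (DX-K n m))

-- Evaluate every variable x_u at 2. The diagonal entry x_u + 0 of D_X(K_{n,m}) then
-- equals 2, the distance between distinct vertices of the same part, so each row of
-- the evaluated matrix depends only on the part of its vertex. Any three rows contain
-- two from the same part, hence every 3×3 minor vanishes at this point. Evaluation is
-- a ring homomorphism ℚ[X] → ℚ, so it kills I₃(K_{n,m}) but not 1.
module Submission where

open import Defs
import Data.Nat as ℕ
open import Data.Nat using (ℕ; zero; suc; NonZero; _<?_; s≤s)
open import Data.Fin using (Fin; zero; suc; toℕ; punchIn; combine; remQuot; _<_; _≟_)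
open import Data.Fin.Properties using (pigeonhole; remQuot-combine)
open import Data.Nat.Properties using (n<1+n)
open import Data.Product using (_,_; uncurry)
open import Data.Rational using (ℚ; 0ℚ; 1ℚ; _+_; _*_; -_)
open import Data.Rational.Properties
  using (+-assoc; +-comm; +-identityˡ; +-inverseˡ; *-assoc; *-comm; *-identityˡ; *-distribˡ-+; *-zeroʳ; 1≢0)
open import Data.Rational.Solver using (module +-*-Solver)
open import Data.Vec using (tabulate)
open import Data.Vec.Properties using (lookup∘tabulate)
open import Function using (_∘_)
open import Relation.Nullary using (¬_; Dec; yes; no; contradiction)
open import Relation.Binary.PropositionalEquality
open ≡-Reasoning

open +-*-Solver using (Polynomial; con; var; _:+_; _:*_; :-_; ⟦_⟧; ⟦_⟧↓; prove)

module _ {N : ℕ} (ρ : Fin N → ℚ) where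

  ev : Poly N → ℚ
  ev (con q) = q
  ev (var i) = ρ i
  ev (p ⊕ q) = ev p + ev q
  ev (p ⊗ q) = ev p * ev q
  ev (⊝ p)   = - ev p

  ev-resp : ∀ {p q} → p ≈ q → ev p ≡ ev q
  ev-resp ≈-refl           = refl
  ev-resp (≈-sym e)        = sym (ev-resp e)
  ev-resp (≈-trans e f)    = trans (ev-resp e) (ev-resp f)
  ev-resp (⊕-cong e f)     = cong₂ _+_ (ev-resp e) (ev-resp f)
  ev-resp (⊗-cong e f)     = cong₂ _*_ (ev-resp e) (ev-resp f)
  ev-resp (⊝-cong e)       = cong -_ (ev-resp e)
  ev-resp (⊕-assoc p q r)  = +-assoc (ev p) (ev q) (ev r)
  ev-resp (⊕-comm p q)     = +-comm (ev p) (ev q)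
  ev-resp (⊕-idˡ p)        = +-identityˡ (ev p)
  ev-resp (⊝-invˡ p)       = +-inverseˡ (ev p)
  ev-resp (⊗-assoc p q r)  = *-assoc (ev p) (ev q) (ev r)
  ev-resp (⊗-comm p q)     = *-comm (ev p) (ev q)
  ev-resp (⊗-idˡ p)        = *-identityˡ (ev p)
  ev-resp (distribˡ p q r) = *-distribˡ-+ (ev p) (ev q) (ev r)
  ev-resp (con-+ a b)      = refl
  ev-resp (con-* a b)      = refl
  ev-resp (con-- a)        = refl

  ev-InIdeal : ∀ {S : Poly N → Set} → (∀ {q} → S q → ev q ≡ 0ℚ) →
               ∀ {p} → InIdeal S p → ev p ≡ 0ℚ
  ev-InIdeal vanish (gen s)    = vanish s
  ev-InIdeal vanish zero       = refl
  ev-InIdeal vanish (add a b)  = cong₂ _+_ (ev-InIdeal vanish a) (ev-InIdeal vanish b)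
  ev-InIdeal vanish (mul r a)  = trans (cong (ev r *_) (ev-InIdeal vanish a)) (*-zeroʳ (ev r))
  ev-InIdeal vanish (resp e a) = trans (sym (ev-resp e)) (ev-InIdeal vanish a)

¬Trivial-InIdeal : ∀ {N} {S : Poly N → Set} (ρ : Fin N → ℚ) →
                   (∀ {q} → S q → ev ρ q ≡ 0ℚ) → ¬ Trivial (InIdeal S)
¬Trivial-InIdeal ρ vanish trivial = 1≢0 (ev-InIdeal ρ vanish (trivial (con 1ℚ)))

module _ {N N′ : ℕ} (ρ : Fin N → ℚ) (ρ′ : Fin N′ → ℚ) where

  ev-sumF-cong : ∀ k (f : Fin k → Poly N) (g : Fin k → Poly N′) →
                 (∀ j → ev ρ (f j) ≡ ev ρ′ (g j)) →
                 ev ρ (sumF k f) ≡ ev ρ′ (sumF k g)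
  ev-sumF-cong zero    f g e = refl
  ev-sumF-cong (suc k) f g e = cong₂ _+_ (e zero) (ev-sumF-cong k (f ∘ suc) (g ∘ suc) (e ∘ suc))

  ev-det-cong : ∀ k (M : Fin k → Fin k → Poly N) (M′ : Fin k → Fin k → Poly N′) →
                (∀ a b → ev ρ (M a b) ≡ ev ρ′ (M′ a b)) →
                ev ρ (det k M) ≡ ev ρ′ (det k M′)
  ev-det-cong zero    M M′ e = refl
  ev-det-cong (suc k) M M′ e = ev-sumF-cong (suc k) (cofactorTerm M) (cofactorTerm M′) λ j →
    cong (signQ (toℕ j) *_)
      (cong₂ _*_ (e zero j) (ev-det-cong k (minor M j) (minor M′ j) λ a b → e (suc a) (punchIn j b)))
    where
    minor : ∀ {L} → (Fin (suc k) → Fin (suc k) → Poly L) → Fin (suc k) → Fin k → Fin k → Poly L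
    minor A j a b = A (suc a) (punchIn j b)

    cofactorTerm : ∀ {L} → (Fin (suc k) → Fin (suc k) → Poly L) → Fin (suc k) → Poly L
    cofactorTerm A j = con (signQ (toℕ j)) ⊗ (A zero j ⊗ det k (minor A j))

reify : ∀ {N} → Poly N → Polynomial N
reify (con q) = con q
reify (var i) = var i
reify (p ⊕ q) = reify p :+ reify q
reify (p ⊗ q) = reify p :* reify q
reify (⊝ p)   = :- reify p

ev-reify : ∀ {N} (ρ : Fin N → ℚ) p → ev ρ p ≡ ⟦ reify p ⟧ (tabulate ρ)
ev-reify ρ (con q) = refl
ev-reify ρ (var i) = sym (lookup∘tabulate ρ i)
ev-reify ρ (p ⊕ q) = cong₂ _+_ (ev-reify ρ p) (ev-reify ρ q)
ev-reify ρ (p ⊗ q) = cong₂ _*_ (ev-reify ρ p) (ev-reify ρ q)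
ev-reify ρ (⊝ p)   = cong -_ (ev-reify ρ p)

ev-by-normalisation : ∀ {N} (ρ : Fin N → ℚ) p q →
                      (∀ ρ′ → ⟦ reify p ⟧↓ ρ′ ≡ ⟦ reify q ⟧↓ ρ′) → ev ρ p ≡ ev ρ q
ev-by-normalisation ρ p q nf = begin
  ev ρ p                   ≡⟨ ev-reify ρ p ⟩
  ⟦ reify p ⟧ (tabulate ρ) ≡⟨ prove (tabulate ρ) (reify p) (reify q) (nf (tabulate ρ)) ⟩
  ⟦ reify q ⟧ (tabulate ρ) ≡⟨ ev-reify ρ q ⟨
  ev ρ q                   ∎

copyRow : (i j : Fin 3) → Fin 3 → Fin 3
copyRow i j a with a ≟ j
... | yes _ = i
... | no _  = a

genericWithRepeatedRow : (i j : Fin 3) → Fin 3 → Fin 3 → Poly 9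
genericWithRepeatedRow i j a b = var (combine (copyRow i j a) b)

-- Each refl below is the ring solver comparing normal forms of a generic 3×3
-- determinant in which one row is a copy of another.
det-genericWithRepeatedRow-nf≡0 : ∀ {i j} → i < j → ∀ ρ →
  ⟦ reify (det 3 (genericWithRepeatedRow i j)) ⟧↓ ρ ≡ ⟦ reify {9} (con 0ℚ) ⟧↓ ρ
det-genericWithRepeatedRow-nf≡0 {zero}        {suc zero}       _ ρ = refl
det-genericWithRepeatedRow-nf≡0 {zero}        {suc (suc zero)} _ ρ = refl
det-genericWithRepeatedRow-nf≡0 {suc zero}    {suc (suc zero)} _ ρ = refl
det-genericWithRepeatedRow-nf≡0 {suc _}       {suc zero}       (s≤s ())
det-genericWithRepeatedRow-nf≡0 {suc (suc _)} {suc (suc zero)} (s≤s (s≤s ()))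

ev-det₃-repeated-row : ∀ {N} (ρ : Fin N → ℚ) (M : Fin 3 → Fin 3 → Poly N) {i j : Fin 3} →
                       i < j → (∀ b → ev ρ (M i b) ≡ ev ρ (M j b)) → ev ρ (det 3 M) ≡ 0ℚ
ev-det₃-repeated-row ρ M {i} {j} i<j rows = begin
  ev ρ (det 3 M)       ≡⟨ ev-det-cong ρ entries 3 M G entries-agree ⟩
  ev entries (det 3 G) ≡⟨ ev-by-normalisation entries (det 3 G) (con 0ℚ)
                            (det-genericWithRepeatedRow-nf≡0 i<j) ⟩
  0ℚ                   ∎
  where
  G : Fin 3 → Fin 3 → Poly 9
  G = genericWithRepeatedRow i j

  entries : Fin 9 → ℚ
  entries k = ev ρ (uncurry M (remQuot {3} 3 k))

  copyRow-entry : ∀ a b → ev ρ (M a b) ≡ ev ρ (M (copyRow i j a) b)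
  copyRow-entry a b with a ≟ j
  ... | yes refl = sym (rows b)
  ... | no _     = refl

  entries-agree : ∀ a b → ev ρ (M a b) ≡ ev entries (G a b)
  entries-agree a b = trans (copyRow-entry a b)
                            (cong (ev ρ ∘ uncurry M) (sym (remQuot-combine (copyRow i j a) b)))

part : (n m : ℕ) → Fin (n ℕ.+ m) → Fin 2
part n m u = side (toℕ u <? n)
  where
  side : ∀ {P : Set} → Dec P → Fin 2
  side (yes _) = zero
  side (no _)  = suc zero

entryAt2 : Fin 2 → Fin 2 → ℚ
entryAt2 zero       zero       = 2ℚ
entryAt2 (suc zero) (suc zero) = 2ℚ
entryAt2 zero       (suc zero) = 1ℚ
entryAt2 (suc zero) zero       = 1ℚ

entryAt2-diag : ∀ p → entryAt2 p p ≡ 2ℚ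
entryAt2-diag zero       = refl
entryAt2-diag (suc zero) = refl

distK-refl : ∀ n m u → distK n m u u ≡ 0ℚ
distK-refl n m u with u ≟ u
... | yes _  = refl
... | no u≢u = contradiction refl u≢u

distK-distinct : ∀ n m {u v} → u ≢ v → distK n m u v ≡ entryAt2 (part n m u) (part n m v)
distK-distinct n m {u} {v} u≢v with u ≟ v
... | yes u≡v = contradiction u≡v u≢v
... | no _ with toℕ u <? n | toℕ v <? n
...   | yes _ | yes _ = refl
...   | yes _ | no _  = refl
...   | no _  | yes _ = refl
...   | no _  | no _  = refl

ev-DX-K-at-2 : ∀ n m u v → ev (λ _ → 2ℚ) (DX-K n m u v) ≡ entryAt2 (part n m u) (part n m v)
ev-DX-K-at-2 n m u v with u ≟ v
... | yes refl = trans (cong (2ℚ +_) (distK-refl n m u)) (sym (entryAt2-diag (part n m u)))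
... | no u≢v  = trans (+-identityˡ _) (distK-distinct n m u≢v)

minor-DX-K-vanishes-at-2 : ∀ n m {q} → IsMinor 3 (DX-K n m) q → ev (λ _ → 2ℚ) q ≡ 0ℚ
minor-DX-K-vanishes-at-2 n m (r , c , _ , _ , refl)
  with i , j , i<j , samePart ← pigeonhole (n<1+n 2) (part n m ∘ r) =
  ev-det₃-repeated-row (λ _ → 2ℚ) (λ a b → DX-K n m (r a) (c b)) i<j λ b → begin
    ev (λ _ → 2ℚ) (DX-K n m (r i) (c b))      ≡⟨ ev-DX-K-at-2 n m (r i) (c b) ⟩
    entryAt2 (part n m (r i)) (part n m (c b)) ≡⟨ cong (λ p → entryAt2 p (part n m (c b))) samePart ⟩
    entryAt2 (part n m (r j)) (part n m (c b)) ≡⟨ ev-DX-K-at-2 n m (r j) (c b) ⟨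
    ev (λ _ → 2ℚ) (DX-K n m (r j) (c b))      ∎

mainTheorem17 : (n m : ℕ) → NonZero n → NonZero m →
    ¬ Trivial (DistanceIdealK 3 n m)
mainTheorem17 n m _ _ = ¬Trivial-InIdeal (λ _ → 2ℚ) (minor-DX-K-vanishes-at-2 n m)
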